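{- Let $\mathcal{G}$ be a downward closed collection of episodes over a finite alphabet $\Sigma$ and let $M(\mathcal{G})$ be the episode machine of $\mathcal{G}$. For every episode $G \in \mathcal{G}$, with $v$ the state of $M(\mathcal{G})$ corresponding to $G$, and every sequence $s$ over $\Sigma$: $s$ covers the episode $G$ if and only if $s$ covers the state $v$ in $M(\mathcal{G})$. Consequently, $s$ is a minimal window of $G$ if and only if $s$ is a minimal window of the state $v$.
   Context: A sequence is a string $s = s_1 \cdots s_L$ with $s_i \in \Sigma$. For $1 \le i \le j \le L$, $s[i,j] = s_i \cdots s_j$; $s[i,j]$ is the empty sequence if $i > j$. An episode is a directed acyclic graph $G = (V, E, \mathrm{lab})$ with labeling $\mathrm{lab}: V \to \Sigma$. A sequence $s$ covers $G$ if there is an injective map $f$ from $V$ to $\{1,\dots,L\}$ such that $s_{f(v)} = \mathrm{lab}(v)$ for every $v \in V$, and $f(v) < f(w)$ for every edge $(v,w) \in E$. A sink of $G$ is a node with no outgoing edges. For a node $n$, $G - n$ is the episode obtained by removing $n$ and its incident edges. A collection $\mathcal{G}$ of episodes is downward closed if it contains every subgraph of each of its members; in particular it contains the empty episode. A sequence $s$ is a minimal window of $G$ if $s$ covers $G$ but no proper contiguous sub-window of $s$ covers $G$. A machine is a finite directed acyclic graph whose edges $e$ carry labels $\mathrm{lab}(e) \in \Sigma$, with a designated initial state $i$. A sequence $s$ of length $L$ covers a state $v$ if there are indices $i_1 < \dots < i_N$ and a directed path from $i$ to $v$ with $N$ edges whose labels are, in order, $s_{i_1}, \dots, s_{i_N}$.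 The initial state is covered by every sequence. A sequence $s$ of length $L$ is a minimal window of state $v$ if $s$ covers $v$ but neither $s[1,L-1]$ nor $s[2,L]$ covers $v$. The episode machine $M(\mathcal{G})$ is defined as follows. Its states are the episodes in $\mathcal{G}$, and its initial state is the empty episode. For episodes $X, Y \in \mathcal{G}$ there is an edge from $X$ to $Y$ with label $a$ if and only if $X = Y - n$ for some sink $n$ of $Y$ with $\mathrm{lab}(n) = a$. -}

module Defs where

open import Data.Nat using (ℕ; zero; suc; _+_; _∸_; _≤_)
open import Data.Fin using (Fin; _<_; punchIn)
open import Data.Bool using (Bool; true; false)
open import Data.List using (List; []; _∷_; length; take; drop)
open import Data.List.Relation.Binary.Sublist.Propositional using (_⊆_)
open import Data.Product using (Σ; _×_; _,_; ∃)
open import Relation.Binary.PropositionalEquality using (_≡_)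
open import Relation.Binary.Construct.Closure.Transitive using (TransClosure)
open import Relation.Nullary using (¬_)
open import Function.Definitions using (Injective)

-- Episodes: labelled directed graphs on the vertex set Fin size.
-- (Acyclicity is a separate predicate; see `Acyclic`.)

record Episode (k : ℕ) : Set where
  constructor ep
  field
    size : ℕ
    lab  : Fin size → Fin k
    E    : Fin size → Fin size → Bool

open Episode public

module _ {k : ℕ} where

  Edge : (G : Episode k) → Fin (size G) → Fin (size G) → Set
  Edge G u w = E G u w ≡ true

  Acyclic : Episode k → Set
  Acyclic G = ∀ v → ¬ TransClosure (Edge G) v v

  IsSink : (G : Episode k) → Fin (size G) → Set
  IsSink G n = ∀ w → E G n w ≡ false

  emptyEp : Episode k
  emptyEp = ep zero (λ ()) (λ ())

  _-node_ : (G : Episode k) → Fin (size G) → Episode k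
  ep zero    l e -node ()
  ep (suc m) l e -node n = ep m (λ i → l (punchIn n i)) (λ u w → e (punchIn n u) (punchIn n w))

  data _≈E_ : Episode k → Episode k → Set where
    ext : ∀ {n l l′ e e′} → (∀ i → l i ≡ l′ i) → (∀ u w → e u w ≡ e′ u w) →
          ep n l e ≈E ep n l′ e′

  -- X is a subgraph of Y: a subset of the vertices (embedded order-preservingly,
  -- i.e. canonically reindexed) with the same labels, and a subset of the
  -- edges among them.
  _⊑_ : Episode k → Episode k → Set
  X ⊑ Y = Σ (Fin (size X) → Fin (size Y)) λ h →
            (∀ i j → i < j → h i < h j) ×
            (∀ i → lab X i ≡ lab Y (h i)) ×
            (∀ u w → Edge X u w → Edge Y (h u) (h w))

  record DownwardClosed (𝒢 : Episode k → Set) : Set where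
    field
      members-acyclic : ∀ {G} → 𝒢 G → Acyclic G
      closed          : ∀ {X Y} → 𝒢 Y → X ⊑ Y → 𝒢 X
      has-empty       : 𝒢 emptyEp

  lookupL : (s : List (Fin k)) → Fin (length s) → Fin k
  lookupL (x ∷ s) Fin.zero    = x
  lookupL (x ∷ s) (Fin.suc i) = lookupL s i

  CoversEp : Episode k → List (Fin k) → Set
  CoversEp G s = Σ (Fin (size G) → Fin (length s)) λ f →
                   Injective _≡_ _≡_ f ×
                   (∀ v → lookupL s (f v) ≡ lab G v) ×
                   (∀ v w → Edge G v w → f v < f w)

  -- Contiguous window obtained by dropping d symbols at the front and
  -- t symbols at the back (empty if d + t ≥ length s).
  window : ℕ → ℕ → List (Fin k) → List (Fin k)
  window d t s = take (length s ∸ (d + t)) (drop d s)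

  MinWindowEp : Episode k → List (Fin k) → Set
  MinWindowEp G s = CoversEp G s × (∀ d t → 1 ≤ d + t → ¬ CoversEp G (window d t s))

  record Machine : Set₁ where
    field
      State : Set
      _≈S_  : State → State → Set
      init  : State
      Step  : State → Fin k → State → Set

  module _ (M : Machine) where
    open Machine M

    data Path : State → List (Fin k) → State → Set where
      here : ∀ {x y} → x ≈S y → Path x [] y
      step : ∀ {x a y w z} → Step x a y → Path y w z → Path x (a ∷ w) z

    CoversState : State → List (Fin k) → Set
    CoversState v s = ∃ λ w → Path init w v × (w ⊆ s)

    -- s[1,L-1] = take (L ∸ 1) s ,  s[2,L] = drop 1 s
    MinWindowState : State → List (Fin k) → Set
    MinWindowState v s = CoversState v s ×
                         ¬ CoversState v (take (length s ∸ 1) s) ×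
                         ¬ CoversState v (drop 1 s)

  -- States are episodes of 𝒢 (a state is a pair
  -- of an episode and its membership proof; two states are the same state
  -- when the episodes are equal, regardless of the proof).

  EpisodeMachine : (𝒢 : Episode k → Set) → DownwardClosed 𝒢 → Machine
  EpisodeMachine 𝒢 dc = record
    { State = Σ (Episode k) 𝒢
    ; _≈S_  = λ { (X , _) (Y , _) → X ≈E Y }
    ; init  = emptyEp , DownwardClosed.has-empty dc
    ; Step  = λ { (X , _) a (Y , _) →
                  Σ (Fin (size Y)) λ n → IsSink Y n × lab Y n ≡ a × X ≈E (Y -node n) }
    }

-- A path of M(𝒢) from the empty episode to G adds the nodes of G one at a
-- time, each as a sink of the episode built so far.  Reading the path along
-- a subsequence of s, each new sink can be placed at the position of its
-- label, after all of its predecessors, so s covers G.  Conversely, if s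
-- covers G, the node placed at the largest position is a sink; removing it
-- leaves an episode of 𝒢 covered by the prefix of s strictly before that
-- position, and induction on the size of G yields the path.  Minimal windows
-- agree because both covering relations are upward closed under
-- subsequences, and every proper contiguous window lies inside s[1,L-1] or
-- s[2,L].
module Submission where

open import Defs
open import Data.Nat using (ℕ)
open import Data.Fin using (Fin)
open import Data.List using (List)
open import Data.Product using (_×_; _,_)
open import Function.Bundles using (_⇔_)

open import Data.Nat using (zero; suc; _∸_; _+_; _≤_; _<_; z≤n; s≤s; z<s; s<s)
open import Data.Nat.Properties
  using (<-cmp; <⇒≢; <⇒≤; <⇒≱; ≤∧≢⇒<; ≤-reflexive; ∸-monoʳ-≤)
open import Data.Fin as Fin using (punchIn; punchOut; toℕ; _≟_)
import Data.Fin.Properties as Fin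
open import Data.Bool using (true; false)
open import Data.List using ([]; _∷_; _++_; [_]; length; take; drop; allFin)
open import Data.List.Properties using (++-identityʳ; ++-assoc; take-all; length-drop)
open import Data.List.Extrema.Nat using (argmax; f[xs]≤f[argmax])
open import Data.List.Membership.Propositional.Properties using (∈-allFin)
import Data.List.Relation.Unary.All as All
open import Data.List.Relation.Binary.Sublist.Propositional
  using (_⊆_; []; _∷_; _∷ʳ_; ⊆-refl; ⊆-trans; ⊆-reflexive)
open import Data.List.Relation.Binary.Sublist.Propositional.Properties
  using ([]⊆-universal; take-⊆; take⁺; drop⁺-≥; ++⁺)
open import Data.Product using (∃-syntax; proj₁; proj₂)
open import Data.Product.Function.NonDependent.Propositional using (_×-⇔_)
open import Data.Sum using (_⊎_; inj₁; inj₂)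
open import Function.Base using (_∘_)
open import Function.Bundles using (mk⇔; Equivalence)
open import Function.Definitions using (Injective)
open import Function.Properties.Equivalence using () renaming (trans to ⇔-trans)
open import Relation.Binary.Core using (_=[_]⇒_)
open import Relation.Binary.Definitions using (tri<; tri≈; tri>)
open import Relation.Binary.PropositionalEquality
  using (_≡_; refl; sym; trans; cong; subst; subst₂)
open import Relation.Nullary using (¬_; yes; no; contradiction)

private
  ¬-cong-⇔ : ∀ {A B : Set} → A ⇔ B → (¬ A) ⇔ (¬ B)
  ¬-cong-⇔ A⇔B = mk⇔ (λ ¬a b → ¬a (from b)) (λ ¬b a → ¬b (to a))
    where open Equivalence A⇔B

module _ {k : ℕ} where

  data _[_]=_ : List (Fin k) → ℕ → Fin k → Set where
    here  : ∀ {a s} → (a ∷ s) [ zero ]= a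
    there : ∀ {x s i a} → s [ i ]= a → (x ∷ s) [ suc i ]= a

  lookupL-[]= : ∀ s (j : Fin (length s)) → s [ toℕ j ]= lookupL s j
  lookupL-[]= (x ∷ s) Fin.zero    = here
  lookupL-[]= (x ∷ s) (Fin.suc j) = there (lookupL-[]= s j)

  []=⇒lookupL : ∀ {s i a} → s [ i ]= a →
                ∃[ j ] toℕ j ≡ i × lookupL s j ≡ a
  []=⇒lookupL here      = Fin.zero , refl , refl
  []=⇒lookupL (there p) with []=⇒lookupL p
  ... | j , toℕj≡i , sⱼ≡a = Fin.suc j , cong suc toℕj≡i , sⱼ≡a

  []=⇒<length : ∀ {s i a} → s [ i ]= a → i < length s
  []=⇒<length here      = z<s
  []=⇒<length (there p) = s<s ([]=⇒<length p)

  []=-++ : ∀ {s i a} t → s [ i ]= a → (s ++ t) [ i ]= a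
  []=-++ t here      = here
  []=-++ t (there p) = there ([]=-++ t p)

  []=-∷ʳ-length : ∀ s a → (s ++ [ a ]) [ length s ]= a
  []=-∷ʳ-length []      a = here
  []=-∷ʳ-length (x ∷ s) a = there ([]=-∷ʳ-length s a)

  []=-take : ∀ {s i a b} → s [ i ]= a → i < b → take b s [ i ]= a
  []=-take {b = suc b} here      _         = here
  []=-take {b = suc b} (there p) (s≤s i<b) = there ([]=-take p i<b)

  take-∷ʳ-⊆ : ∀ {s i a} → s [ i ]= a → take i s ++ [ a ] ⊆ s
  take-∷ʳ-⊆ {_ ∷ s} here      = refl ∷ []⊆-universal s
  take-∷ʳ-⊆         (there p) = refl ∷ take-∷ʳ-⊆ p

  -- CoversEp with positions in ℕ instead of Fin (length s), so that covers
  -- can be transported along u ++ w without casts.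
  record Covers (G : Episode k) (s : List (Fin k)) : Set where
    constructor covers
    field
      pos      : Fin (size G) → ℕ
      pos-inj  : Injective _≡_ _≡_ pos
      pos-lab  : ∀ v → s [ pos v ]= lab G v
      pos-edge : ∀ v w → Edge G v w → pos v < pos w

  CoversEp⇔Covers : ∀ G s → CoversEp G s ⇔ Covers G s
  CoversEp⇔Covers G s = mk⇔ to from
    where
      to : CoversEp G s → Covers G s
      to (f , f-inj , f-lab , f-edge) =
        covers (λ v → toℕ (f v)) (λ eq → f-inj (Fin.toℕ-injective eq))
               (λ v → subst (s [ toℕ (f v) ]=_) (f-lab v) (lookupL-[]= s (f v)))
               f-edge
      from : Covers G s → CoversEp G s
      from (covers pos pos-inj pos-lab pos-edge) =
        index , index-inj , lookupL-index , index-edge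
        where
          index : Fin (size G) → Fin (length s)
          index v = proj₁ ([]=⇒lookupL (pos-lab v))
          toℕ-index : ∀ v → toℕ (index v) ≡ pos v
          toℕ-index v = proj₁ (proj₂ ([]=⇒lookupL (pos-lab v)))
          lookupL-index : ∀ v → lookupL s (index v) ≡ lab G v
          lookupL-index v = proj₂ (proj₂ ([]=⇒lookupL (pos-lab v)))
          index-inj : Injective _≡_ _≡_ index
          index-inj {v} {w} eq =
            pos-inj (trans (sym (toℕ-index v)) (trans (cong toℕ eq) (toℕ-index w)))
          index-edge : ∀ v w → Edge G v w → index v Fin.< index w
          index-edge v w e =
            subst₂ _<_ (sym (toℕ-index v)) (sym (toℕ-index w)) (pos-edge v w e)

  strictlyMonotone⇒injective : ∀ {φ : ℕ → ℕ} → _<_ =[ φ ]⇒ _<_ → Injective _≡_ _≡_ φ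
  strictlyMonotone⇒injective mono {i} {j} eq with <-cmp i j
  ... | tri< i<j _ _ = contradiction eq (<⇒≢ (mono i<j))
  ... | tri≈ _ i≡j _ = i≡j
  ... | tri> _ _ j<i = contradiction (sym eq) (<⇒≢ (mono j<i))

  ⊆⇒reindexing : ∀ {w s} → w ⊆ s →
                 ∃[ φ ] (∀ {i a} → w [ i ]= a → s [ φ i ]= a) × (_<_ =[ φ ]⇒ _<_)
  ⊆⇒reindexing []       = (λ i → i) , (λ ()) , (λ i<j → i<j)
  ⊆⇒reindexing (y ∷ʳ p) with ⊆⇒reindexing p
  ... | φ , φ-[]= , φ-mono = suc ∘ φ , there ∘ φ-[]= , s<s ∘ φ-mono
  ⊆⇒reindexing (refl ∷ p) with ⊆⇒reindexing p
  ... | φ , φ-[]= , φ-mono = ψ , ψ-[]= , ψ-mono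
    where
      ψ : ℕ → ℕ
      ψ zero    = zero
      ψ (suc i) = suc (φ i)
      ψ-[]= : ∀ {i a} → _ [ i ]= a → _ [ ψ i ]= a
      ψ-[]= here      = here
      ψ-[]= (there q) = there (φ-[]= q)
      ψ-mono : _<_ =[ ψ ]⇒ _<_
      ψ-mono {zero}  {suc j} _         = z<s
      ψ-mono {suc i} {suc j} (s<s i<j) = s<s (φ-mono i<j)

  covers-resp-⊆ : ∀ {G w s} → w ⊆ s → Covers G w → Covers G s
  covers-resp-⊆ w⊆s (covers pos pos-inj pos-lab pos-edge) with ⊆⇒reindexing w⊆s
  ... | φ , φ-[]= , φ-mono =
    covers (φ ∘ pos) (pos-inj ∘ strictlyMonotone⇒injective φ-mono)
           (φ-[]= ∘ pos-lab) (λ v w e → φ-mono (pos-edge v w e))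

  coversEp-resp-⊆ : ∀ {G w s} → w ⊆ s → CoversEp G w → CoversEp G s
  coversEp-resp-⊆ {G} {w} {s} w⊆s =
    from (CoversEp⇔Covers G s) ∘ covers-resp-⊆ w⊆s ∘ to (CoversEp⇔Covers G w)
    where open Equivalence

  ≈E-refl : ∀ {X : Episode k} → X ≈E X
  ≈E-refl {ep _ _ _} = ext (λ _ → refl) (λ _ _ → refl)

  ≈E-trans : ∀ {X Y Z : Episode k} → X ≈E Y → Y ≈E Z → X ≈E Z
  ≈E-trans (ext l≗l′ e≗e′) (ext l′≗l″ e′≗e″) =
    ext (λ i → trans (l≗l′ i) (l′≗l″ i)) (λ u w → trans (e≗e′ u w) (e′≗e″ u w))

  covers-resp-≈E : ∀ {X Y u} → X ≈E Y → Covers X u → Covers Y u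
  covers-resp-≈E {u = u} (ext l≗l′ e≗e′) (covers pos pos-inj pos-lab pos-edge) =
    covers pos pos-inj (λ v → subst (u [ pos v ]=_) (l≗l′ v) (pos-lab v))
           (λ v w e → pos-edge v w (trans (e≗e′ v w) e))

  -node-⊑ : ∀ (G : Episode k) n → (G -node n) ⊑ G
  -node-⊑ (ep (suc m) l e) n = punchIn n , punchIn-mono-< , (λ _ → refl) , (λ _ _ e → e)
    where
      punchIn-mono-< : ∀ i j → i Fin.< j → punchIn n i Fin.< punchIn n j
      punchIn-mono-< i j i<j =
        Fin.≤∧≢⇒< (Fin.punchIn-mono-≤ n i j (<⇒≤ i<j))
                  (Fin.<⇒≢ i<j ∘ Fin.punchIn-injective n i j)

  data PunchView {m} (n : Fin (suc m)) : Fin (suc m) → Set where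
    at-n    : PunchView n n
    punched : ∀ i → PunchView n (punchIn n i)

  punchView : ∀ {m} (n v : Fin (suc m)) → PunchView n v
  punchView n v with n ≟ v
  ... | yes refl = at-n
  ... | no n≢v   = subst (PunchView n) (Fin.punchIn-punchOut n≢v) (punched (punchOut n≢v))

  covers-∷ʳ-sink : ∀ {Y n a u} → IsSink Y n → lab Y n ≡ a →
                   Covers (Y -node n) u → Covers Y (u ++ [ a ])
  covers-∷ʳ-sink {ep (suc m) l e} {n} {_} {u} sink refl
                 (covers pos pos-inj pos-lab pos-edge) =
    covers pos′ pos′-inj pos′-lab pos′-edge
    where
      below : ∀ i → pos i < length u
      below i = []=⇒<length (pos-lab i)
      pos′ : Fin (suc m) → ℕ
      pos′ v with punchView n v
      ... | at-n      = length u
      ... | punched i = pos i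
      pos′-inj : Injective _≡_ _≡_ pos′
      pos′-inj {v} {w} eq with punchView n v | punchView n w
      ... | at-n      | at-n      = refl
      ... | at-n      | punched j = contradiction (sym eq) (<⇒≢ (below j))
      ... | punched i | at-n      = contradiction eq (<⇒≢ (below i))
      ... | punched i | punched j = cong (punchIn n) (pos-inj eq)
      pos′-lab : ∀ v → (u ++ [ l n ]) [ pos′ v ]= l v
      pos′-lab v with punchView n v
      ... | at-n      = []=-∷ʳ-length u (l n)
      ... | punched i = []=-++ [ l n ] (pos-lab i)
      pos′-edge : ∀ v w → e v w ≡ true → pos′ v < pos′ w
      pos′-edge v w vw with punchView n v | punchView n w
      ... | at-n      | _         = contradiction (trans (sym (sink _)) vw) λ ()
      ... | punched i | at-n      = below i
      ... | punched i | punched j = pos-edge i j vw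

  maximalPosition : ∀ {m} (f : Fin (suc m) → ℕ) → ∃[ n ] (∀ v → f v ≤ f n)
  maximalPosition {m} f =
    argmax f Fin.zero (allFin (suc m)) ,
    λ v → All.lookup (f[xs]≤f[argmax] {f = f} Fin.zero (allFin (suc m))) (∈-allFin v)

  maximal⇒sink : ∀ {G s} (c : Covers G s) {n} → (∀ v → Covers.pos c v ≤ Covers.pos c n) →
                 IsSink G n
  maximal⇒sink {G} (covers _ _ _ pos-edge) {n} max w with E G n w in nw
  ... | true  = contradiction (max w) (<⇒≱ (pos-edge n w nw))
  ... | false = refl

  covers-node-take : ∀ {G s} (c : Covers G s) n → (∀ v → Covers.pos c v ≤ Covers.pos c n) →
                     Covers (G -node n) (take (Covers.pos c n) s)
  covers-node-take {ep (suc m) l e} (covers pos pos-inj pos-lab pos-edge) n max =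
    covers (pos ∘ punchIn n) (Fin.punchIn-injective n _ _ ∘ pos-inj)
           (λ i → []=-take (pos-lab (punchIn n i)) (below i)) (λ i j → pos-edge _ _)
    where
      below : ∀ i → pos (punchIn n i) < pos n
      below i = ≤∧≢⇒< (max _) (Fin.punchInᵢ≢i n i ∘ pos-inj)

  module _ (𝒢 : Episode k → Set) (dc : DownwardClosed 𝒢) where
    open Machine (EpisodeMachine 𝒢 dc)
    open DownwardClosed dc

    private
      M : Machine
      M = EpisodeMachine 𝒢 dc

    step-covers : ∀ {X a Y u} → Step X a Y → Covers (proj₁ X) u → Covers (proj₁ Y) (u ++ [ a ])
    step-covers {_ , _} {Y = _ , _} (n , sink , lab≡a , X≈Y-n) =
      covers-∷ʳ-sink sink lab≡a ∘ covers-resp-≈E X≈Y-n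

    path-covers : ∀ {X w Y u} → Path M X w Y → Covers (proj₁ X) u → Covers (proj₁ Y) (u ++ w)
    path-covers {X , _} {Y = Y , _} {u} (here X≈Y) =
      subst (Covers Y) (sym (++-identityʳ u)) ∘ covers-resp-≈E X≈Y
    path-covers {X} {a ∷ w} {Y , _} {u} (step {y = Z} st p) =
      subst (Covers Y) (++-assoc u [ a ] w) ∘ path-covers p ∘ step-covers {X} {Y = Z} st

    coversState⇒covers : ∀ {G g s} → CoversState M (G , g) s → Covers G s
    coversState⇒covers (w , p , w⊆s) =
      covers-resp-⊆ w⊆s (path-covers p (covers (λ ()) (λ {}) (λ ()) (λ ())))

    path-∷ʳ : ∀ {X w Y a Z} → Path M X w Y → Step Y a Z → Path M X (w ++ [ a ]) Z
    path-∷ʳ {_ , _} {Y = _ , _} {Z = Z} (here X≈Y) (n , sink , lab≡a , Y≈Z-n) =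
      step {y = Z} (n , sink , lab≡a , ≈E-trans X≈Y Y≈Z-n) (here ≈E-refl)
    path-∷ʳ (step st p) st′ = step st (path-∷ʳ p st′)

    covers⇒coversState : ∀ {m l e} (g : 𝒢 (ep m l e)) {s} →
                         Covers (ep m l e) s → CoversState M (ep m l e , g) s
    covers⇒coversState {zero} _ {s} _ = [] , here (ext (λ ()) (λ ())) , []⊆-universal s
    covers⇒coversState {suc m} {l} {e} g c@(covers pos _ pos-lab _) with maximalPosition pos
    ... | n , max
      with covers⇒coversState (closed g (-node-⊑ (ep (suc m) l e) n)) (covers-node-take c n max)
    ... | w , p , w⊆prefix =
      w ++ [ l n ] ,
      path-∷ʳ p (n , maximal⇒sink c max , refl , ≈E-refl) ,
      ⊆-trans (++⁺ w⊆prefix ⊆-refl) (take-∷ʳ-⊆ (pos-lab n))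

    coversEp⇔coversState : ∀ {G} (g : 𝒢 G) s → CoversEp G s ⇔ CoversState M (G , g) s
    coversEp⇔coversState {G@(ep _ _ _)} g s =
      ⇔-trans (CoversEp⇔Covers G s) (mk⇔ (covers⇒coversState g) coversState⇒covers)

  window-⊆-shrink : ∀ d t (s : List (Fin k)) → 1 ≤ d + t →
                    window d t s ⊆ take (length s ∸ 1) s ⊎ window d t s ⊆ drop 1 s
  window-⊆-shrink zero    t s 1≤t = inj₁ (take⁺ (∸-monoʳ-≤ (length s) 1≤t))
  window-⊆-shrink (suc d) t s _   =
    inj₂ (⊆-trans (take-⊆ _ (drop (suc d) s)) (drop⁺-≥ {xs = s} (s≤s z≤n)))

  drop-1-⊆-window : ∀ (s : List (Fin k)) → drop 1 s ⊆ window 1 0 s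
  drop-1-⊆-window s =
    ⊆-reflexive (sym (take-all (length s ∸ 1) (drop 1 s) (≤-reflexive (length-drop 1 s))))

  noProperWindow⇔ : ∀ {P : List (Fin k) → Set} → (∀ {u v} → u ⊆ v → P u → P v) →
                    ∀ (s : List (Fin k)) →
                    (∀ d t → 1 ≤ d + t → ¬ P (window d t s)) ⇔
                    (¬ P (take (length s ∸ 1) s) × ¬ P (drop 1 s))
  noProperWindow⇔ {P} P-up s = mk⇔ to from
    where
      to : (∀ d t → 1 ≤ d + t → ¬ P (window d t s)) →
           ¬ P (take (length s ∸ 1) s) × ¬ P (drop 1 s)
      to none = none 0 1 (s≤s z≤n) , none 1 0 (s≤s z≤n) ∘ P-up (drop-1-⊆-window s)
      from : ¬ P (take (length s ∸ 1) s) × ¬ P (drop 1 s) →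
             ∀ d t → 1 ≤ d + t → ¬ P (window d t s)
      from (¬init , ¬tail) d t 1≤d+t with window-⊆-shrink d t s 1≤d+t
      ... | inj₁ ⊆init = ¬init ∘ P-up ⊆init
      ... | inj₂ ⊆tail = ¬tail ∘ P-up ⊆tail

mainTheorem1 : (k : ℕ) (𝒢 : Episode k → Set) (dc : DownwardClosed 𝒢)
    (G : Episode k) (g : 𝒢 G) (s : List (Fin k)) →
    (CoversEp G s ⇔ CoversState (EpisodeMachine 𝒢 dc) (G , g) s) ×
    (MinWindowEp G s ⇔ MinWindowState (EpisodeMachine 𝒢 dc) (G , g) s)
mainTheorem1 k 𝒢 dc G g s =
  covers⇔ s ,
  (covers⇔ s ×-⇔ ⇔-trans (noProperWindow⇔ (coversEp-resp-⊆ {G = G}) s)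
                         (¬-cong-⇔ (covers⇔ _) ×-⇔ ¬-cong-⇔ (covers⇔ _)))
  where
    covers⇔ : ∀ u → CoversEp G u ⇔ CoversState (EpisodeMachine 𝒢 dc) (G , g) u
    covers⇔ = coversEp⇔coversState 𝒢 dc g
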